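{- Let $G=\gamma_1\square\cdots\square\gamma_n$, where each $\gamma_i$ ($1\le i\le n$) is a bicolored directed path. Then $G$ has a bikernel if and only if every $\gamma_i$ has a bikernel.
   Context: A bicolored digraph has each arc colored $1$ or $2$. The Cartesian product $D_1\square D_2$ has vertex set $V(D_1)\times V(D_2)$ and arcs $((u,v_1),(u,v_2))$ for $u\in V(D_1)$, $(v_1,v_2)\in A(D_2)$, and $((u_1,v),(u_2,v))$ for $v\in V(D_2)$, $(u_1,u_2)\in A(D_1)$, each colored with the color of the corresponding arc in $D_1$ or $D_2$; iterated products are formed in the same way. A non-empty set $B\subseteq V(G)$ is a bikernel (by monochromatic paths) if: (i) for all distinct $u,v\in B$ there is no monochromatic directed $uv$-path; (ii) for every $v\in V(G)\setminus B$ there is a directed path of color $1$ from $v$ to a vertex of $B$; (iii) for every $v\in V(G)\setminus B$ there is a directed path of color $2$ from a vertex of $B$ to $v$. -}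

module Defs where

open import Data.Nat using (ℕ; suc)
open import Data.Fin using (Fin; zero; suc; inject₁)
open import Data.Bool using (Bool; true; false)
open import Data.Product using (Σ; ∃; _×_; _,_)
open import Data.Sum using (_⊎_)
open import Relation.Nullary using (¬_)
open import Relation.Binary.PropositionalEquality using (_≡_; _≢_)
open import Relation.Binary.Construct.Closure.ReflexiveTransitive using (Star)

data Color : Set where
  c₁ c₂ : Color

record BiDigraph : Set₁ where
  field
    V   : Set
    arc : Color → V → V → Set
open BiDigraph public

_□_ : BiDigraph → BiDigraph → BiDigraph
D₁ □ D₂ = record
  { V   = V D₁ × V D₂
  ; arc = λ { c (u₁ , u₂) (w₁ , w₂) →
              (u₁ ≡ w₁ × arc D₂ c u₂ w₂) ⊎ (arc D₁ c u₁ w₁ × u₂ ≡ w₂) }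
  }

-- A bicoloured directed path with `len` arcs: vertices 0,1,…,len,
-- arc i goes from vertex i to vertex i+1 and has colour `col i`.
record BiPath : Set where
  field
    len : ℕ
    col : Fin len → Color
open BiPath public

pathD : BiPath → BiDigraph
pathD p = record
  { V   = Fin (suc (len p))
  ; arc = λ c u v → Σ (Fin (len p)) λ i →
            u ≡ inject₁ i × v ≡ suc i × col p i ≡ c
  }

-- Iterated product γ₀ □ (γ₁ □ (⋯ □ γₙ)) of n+1 digraphs.
⨂ : (n : ℕ) → (Fin (suc n) → BiDigraph) → BiDigraph
⨂ ℕ.zero    γ = γ zero
⨂ (suc n) γ = γ zero □ ⨂ n (λ i → γ (suc i))

-- Existence of a directed (monochromatic) path of colour c from u to v
-- (as a walk; existence of a walk ⇔ existence of a path).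
MonoPath : (D : BiDigraph) → Color → V D → V D → Set
MonoPath D c = Star (arc D c)

IsBikernel : (D : BiDigraph) → (V D → Bool) → Set
IsBikernel D B =
    (∃ λ v → B v ≡ true)
  × (∀ u v → B u ≡ true → B v ≡ true → u ≢ v → ∀ c → ¬ MonoPath D c u v)
  × (∀ v → B v ≡ false → ∃ λ b → B b ≡ true × MonoPath D c₁ v b)
  × (∀ v → B v ≡ false → ∃ λ b → B b ≡ true × MonoPath D c₂ b v)

HasBikernel : BiDigraph → Set
HasBikernel D = ∃ λ (B : V D → Bool) → IsBikernel D B

-- Bikernels multiply: the product B₁ × B₂ of bikernels is a bikernel of D₁ □ D₂, since
-- monochromatic walks of a product project to both factors and walks of the factors combine.
-- Conversely, a bikernel of the product restricts to the slice through a source of the other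
-- factors as an independent set that dominates by colour-2 paths, and to the slice through a
-- sink as an independent set that absorbs by colour-1 paths; both slices are closed under the
-- relevant walks because no walk enters a source or leaves a sink. On a path these two
-- half-kernels force the colours to alternate 2,1,2,…,1, and then the vertices 0,2,4,…
-- form a bikernel.
module Submission where

open import Defs
open import Data.Nat using (ℕ; suc)
open import Data.Fin using (Fin; zero; suc; inject₁; fromℕ)
open import Data.Fin.Properties using (fromℕ≢inject₁; inject₁-injective; suc-injective)
open import Data.Fin.Relation.Unary.Top using (view; ‵fromℕ; ‵inj₁)
open import Data.Product using (_×_; ∃; _,_; proj₁; proj₂)
open import Data.Sum using (_⊎_; inj₁; inj₂)
open import Data.Bool using (Bool; true; false; _∧_)
open import Data.Bool.Properties using (∧-conicalˡ; ∧-conicalʳ)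
open import Data.Empty using (⊥; ⊥-elim)
open import Function using (_∘_; flip)
open import Relation.Nullary using (¬_)
open import Relation.Binary.PropositionalEquality
open import Relation.Binary.Construct.Closure.ReflexiveTransitive using (ε; _◅_; _◅◅_; gmap)

Independent : (D : BiDigraph) → (V D → Bool) → Set
Independent D B = ∀ u v → B u ≡ true → B v ≡ true → u ≢ v → ∀ c → ¬ MonoPath D c u v

-- `R v b` reads "b covers v".
Covers : (D : BiDigraph) → (V D → V D → Set) → (V D → Bool) → Set
Covers D R B = ∀ v → B v ≡ false → ∃ λ b → B b ≡ true × R v b

Absorbent Dominating : (D : BiDigraph) → (V D → Bool) → Set
Absorbent D = Covers D (MonoPath D c₁)
Dominating D = Covers D (flip (MonoPath D c₂))

HasIndependentCover : (D : BiDigraph) → (V D → V D → Set) → Set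
HasIndependentCover D R = ∃ λ B → Independent D B × Covers D R B

HasIndependentAbsorbent HasIndependentDominating : BiDigraph → Set
HasIndependentAbsorbent D = HasIndependentCover D (MonoPath D c₁)
HasIndependentDominating D = HasIndependentCover D (flip (MonoPath D c₂))

IsSource IsSink : (D : BiDigraph) → V D → Set
IsSource D s = ∀ {c u} → MonoPath D c u s → u ≡ s
IsSink D t = ∀ {c v} → MonoPath D c t v → v ≡ t

module _ {D : BiDigraph} {c : Color} where

  walk-from-stuck : ∀ {u v} → (∀ {w} → ¬ arc D c u w) → MonoPath D c u v → v ≡ u
  walk-from-stuck ¬out ε = refl
  walk-from-stuck ¬out (a ◅ _) = ⊥-elim (¬out a)

  walk-into-stuck : ∀ {u v} → (∀ {w} → ¬ arc D c w v) → MonoPath D c u v → u ≡ v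
  walk-into-stuck ¬in ε = refl
  walk-into-stuck ¬in (a ◅ w) with walk-into-stuck ¬in w
  ... | refl = ⊥-elim (¬in a)

module _ {D : BiDigraph} {R : V D → V D → Set} {B : V D → Bool} where

  covers-reflexive : (∀ {v} → R v v) → Covers D R B → ∀ v → ∃ λ b → B b ≡ true × R v b
  covers-reflexive refl-R cover v with B v in Bv
  ... | true = v , Bv , refl-R
  ... | false = cover v Bv

  covers-uncovered : ∀ {v} → (∀ {b} → R v b → b ≡ v) → Covers D R B → B v ≡ true
  covers-uncovered {v} only-v cover with B v in Bv
  ... | true = refl
  ... | false with cover v Bv
  ... | b , Bb , Rvb = trans (sym Bv) (trans (cong B (sym (only-v Rvb))) Bb)

record Embedding (D P : BiDigraph) : Set where
  field
    embed : V D → V P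
    embed-injective : ∀ {u v} → embed u ≡ embed v → u ≡ v
    embed-walk : ∀ {c u v} → MonoPath D c u v → MonoPath P c (embed u) (embed v)
open Embedding

module _ {D P : BiDigraph} (e : Embedding D P) where

  Reflects : (V P → V P → Set) → (V D → V D → Set) → Set
  Reflects R R′ = ∀ {v x} → R (embed e v) x → ∃ λ a → x ≡ embed e a × R′ v a

  independent-restrict : ∀ {B} → Independent P B → Independent D (B ∘ embed e)
  independent-restrict ind u v Bu Bv u≢v c w =
    ind _ _ Bu Bv (u≢v ∘ embed-injective e) c (embed-walk e w)

  covers-restrict : ∀ {B R R′} → Reflects R R′ → Covers P R B → Covers D R′ (B ∘ embed e)
  covers-restrict reflects cover v Bv with cover (embed e v) Bv
  ... | x , Bx , Rvx with reflects Rvx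
  ... | a , refl , R′va = a , Bx , R′va

  restrict : ∀ {R R′} → Reflects R R′ → HasIndependentCover P R → HasIndependentCover D R′
  restrict reflects (B , ind , cover) =
    B ∘ embed e , independent-restrict ind , covers-restrict reflects cover

module _ {D₁ D₂ : BiDigraph} where

  walk-proj₁ : ∀ {c x y} → MonoPath (D₁ □ D₂) c x y → MonoPath D₁ c (proj₁ x) (proj₁ y)
  walk-proj₁ ε = ε
  walk-proj₁ (inj₁ (refl , _) ◅ w) = walk-proj₁ w
  walk-proj₁ (inj₂ (a , refl) ◅ w) = a ◅ walk-proj₁ w

  walk-proj₂ : ∀ {c x y} → MonoPath (D₁ □ D₂) c x y → MonoPath D₂ c (proj₂ x) (proj₂ y)
  walk-proj₂ ε = ε
  walk-proj₂ (inj₁ (refl , a) ◅ w) = a ◅ walk-proj₂ w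
  walk-proj₂ (inj₂ (_ , refl) ◅ w) = walk-proj₂ w

  walk-injˡ : ∀ {c a a′} b → MonoPath D₁ c a a′ → MonoPath (D₁ □ D₂) c (a , b) (a′ , b)
  walk-injˡ b = gmap (_, b) (λ r → inj₂ (r , refl))

  walk-injʳ : ∀ {c} a {b b′} → MonoPath D₂ c b b′ → MonoPath (D₁ □ D₂) c (a , b) (a , b′)
  walk-injʳ a = gmap (a ,_) (λ r → inj₁ (refl , r))

  walk-pair : ∀ {c a a′ b b′} → MonoPath D₁ c a a′ → MonoPath D₂ c b b′ →
              MonoPath (D₁ □ D₂) c (a , b) (a′ , b′)
  walk-pair {a′ = a′} {b = b} p q = walk-injˡ b p ◅◅ walk-injʳ a′ q

  sliceˡ : V D₂ → Embedding D₁ (D₁ □ D₂)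
  sliceˡ b = record
    { embed = _, b ; embed-injective = cong proj₁ ; embed-walk = walk-injˡ b }

  sliceʳ : V D₁ → Embedding D₂ (D₁ □ D₂)
  sliceʳ a = record
    { embed = a ,_ ; embed-injective = cong proj₂ ; embed-walk = walk-injʳ a }

  dominating-sliceˡ : ∀ {s} → IsSource D₂ s →
                      HasIndependentDominating (D₁ □ D₂) → HasIndependentDominating D₁
  dominating-sliceˡ {s} source = restrict (sliceˡ s) closed
    where
    closed : ∀ {a x} → MonoPath (D₁ □ D₂) c₂ x (a , s) → ∃ λ a′ → x ≡ (a′ , s) × MonoPath D₁ c₂ a′ a
    closed {x = a′ , _} w with source (walk-proj₂ w)
    ... | refl = a′ , refl , walk-proj₁ w

  dominating-sliceʳ : ∀ {s} → IsSource D₁ s →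
                      HasIndependentDominating (D₁ □ D₂) → HasIndependentDominating D₂
  dominating-sliceʳ {s} source = restrict (sliceʳ s) closed
    where
    closed : ∀ {b x} → MonoPath (D₁ □ D₂) c₂ x (s , b) → ∃ λ b′ → x ≡ (s , b′) × MonoPath D₂ c₂ b′ b
    closed {x = _ , b′} w with source (walk-proj₁ w)
    ... | refl = b′ , refl , walk-proj₂ w

  absorbent-sliceˡ : ∀ {t} → IsSink D₂ t →
                     HasIndependentAbsorbent (D₁ □ D₂) → HasIndependentAbsorbent D₁
  absorbent-sliceˡ {t} sink = restrict (sliceˡ t) closed
    where
    closed : ∀ {a x} → MonoPath (D₁ □ D₂) c₁ (a , t) x → ∃ λ a′ → x ≡ (a′ , t) × MonoPath D₁ c₁ a a′
    closed {x = a′ , _} w with sink (walk-proj₂ w)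
    ... | refl = a′ , refl , walk-proj₁ w

  absorbent-sliceʳ : ∀ {t} → IsSink D₁ t →
                     HasIndependentAbsorbent (D₁ □ D₂) → HasIndependentAbsorbent D₂
  absorbent-sliceʳ {t} sink = restrict (sliceʳ t) closed
    where
    closed : ∀ {b x} → MonoPath (D₁ □ D₂) c₁ (t , b) x → ∃ λ b′ → x ≡ (t , b′) × MonoPath D₂ c₁ b b′
    closed {x = _ , b′} w with sink (walk-proj₁ w)
    ... | refl = b′ , refl , walk-proj₂ w

  □-source : ∀ {s₁ s₂} → IsSource D₁ s₁ → IsSource D₂ s₂ → IsSource (D₁ □ D₂) (s₁ , s₂)
  □-source source₁ source₂ w = cong₂ _,_ (source₁ (walk-proj₁ w)) (source₂ (walk-proj₂ w))

  □-sink : ∀ {t₁ t₂} → IsSink D₁ t₁ → IsSink D₂ t₂ → IsSink (D₁ □ D₂) (t₁ , t₂)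
  □-sink sink₁ sink₂ w = cong₂ _,_ (sink₁ (walk-proj₁ w)) (sink₂ (walk-proj₂ w))

  _⊗_ : (V D₁ → Bool) → (V D₂ → Bool) → V (D₁ □ D₂) → Bool
  (B₁ ⊗ B₂) (a , b) = B₁ a ∧ B₂ b

  □-independent : ∀ {B₁ B₂} → Independent D₁ B₁ → Independent D₂ B₂ →
                  Independent (D₁ □ D₂) (B₁ ⊗ B₂)
  □-independent {B₁} ind₁ ind₂ (a , b) (a′ , b′) Bu Bv u≢v c w =
    ind₁ a a′ (∧-conicalˡ _ _ Bu) (∧-conicalˡ _ _ Bv) a≢a′ c (walk-proj₁ w)
    where
    a≢a′ : a ≢ a′
    a≢a′ a≡a′ = ind₂ b b′ (∧-conicalʳ (B₁ a) _ Bu) (∧-conicalʳ (B₁ a′) _ Bv)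
                  (u≢v ∘ cong₂ _,_ a≡a′) c (walk-proj₂ w)

  □-absorbent : ∀ {B₁ B₂} → Absorbent D₁ B₁ → Absorbent D₂ B₂ → Absorbent (D₁ □ D₂) (B₁ ⊗ B₂)
  □-absorbent cover₁ cover₂ (a , b) _
    with covers-reflexive {D₁} ε cover₁ a | covers-reflexive {D₂} ε cover₂ b
  ... | a′ , Ba′ , wa | b′ , Bb′ , wb = (a′ , b′) , cong₂ _∧_ Ba′ Bb′ , walk-pair wa wb

  □-dominating : ∀ {B₁ B₂} → Dominating D₁ B₁ → Dominating D₂ B₂ →
                 Dominating (D₁ □ D₂) (B₁ ⊗ B₂)
  □-dominating cover₁ cover₂ (a , b) _
    with covers-reflexive {D₁} ε cover₁ a | covers-reflexive {D₂} ε cover₂ b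
  ... | a′ , Ba′ , wa | b′ , Bb′ , wb = (a′ , b′) , cong₂ _∧_ Ba′ Bb′ , walk-pair wa wb

  □-bikernel : HasBikernel D₁ → HasBikernel D₂ → HasBikernel (D₁ □ D₂)
  □-bikernel (B₁ , (a , Ba) , ind₁ , abs₁ , dom₁) (B₂ , (b , Bb) , ind₂ , abs₂ , dom₂) =
    B₁ ⊗ B₂ , ((a , b) , cong₂ _∧_ Ba Bb) , □-independent ind₁ ind₂ ,
    □-absorbent abs₁ abs₂ , □-dominating dom₁ dom₂

⨂-bikernel : ∀ n δ → (∀ i → HasBikernel (δ i)) → HasBikernel (⨂ n δ)
⨂-bikernel ℕ.zero δ K = K zero
⨂-bikernel (suc n) δ K = □-bikernel (K zero) (⨂-bikernel n (δ ∘ suc) (K ∘ suc))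

⨂-source : ∀ n δ → (∀ i → ∃ (IsSource (δ i))) → ∃ (IsSource (⨂ n δ))
⨂-source ℕ.zero δ S = S zero
⨂-source (suc n) δ S with S zero | ⨂-source n (δ ∘ suc) (S ∘ suc)
... | s , source | s′ , source′ = (s , s′) , □-source {δ zero} {⨂ n (δ ∘ suc)} source source′

⨂-sink : ∀ n δ → (∀ i → ∃ (IsSink (δ i))) → ∃ (IsSink (⨂ n δ))
⨂-sink ℕ.zero δ T = T zero
⨂-sink (suc n) δ T with T zero | ⨂-sink n (δ ∘ suc) (T ∘ suc)
... | t , sink | t′ , sink′ = (t , t′) , □-sink {δ zero} {⨂ n (δ ∘ suc)} sink sink′

⨂-dominating-factor : ∀ n δ → (∀ i → ∃ (IsSource (δ i))) →
  HasIndependentDominating (⨂ n δ) → ∀ i → HasIndependentDominating (δ i)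
⨂-dominating-factor ℕ.zero δ S K zero = K
⨂-dominating-factor (suc n) δ S K zero with ⨂-source n (δ ∘ suc) (S ∘ suc)
... | s , source = dominating-sliceˡ source K
⨂-dominating-factor (suc n) δ S K (suc i) with S zero
... | s , source = ⨂-dominating-factor n (δ ∘ suc) (S ∘ suc)
                     (dominating-sliceʳ source K) i

⨂-absorbent-factor : ∀ n δ → (∀ i → ∃ (IsSink (δ i))) →
  HasIndependentAbsorbent (⨂ n δ) → ∀ i → HasIndependentAbsorbent (δ i)
⨂-absorbent-factor ℕ.zero δ T K zero = K
⨂-absorbent-factor (suc n) δ T K zero with ⨂-sink n (δ ∘ suc) (T ∘ suc)
... | t , sink = absorbent-sliceˡ sink K
⨂-absorbent-factor (suc n) δ T K (suc i) with T zero
... | t , sink = ⨂-absorbent-factor n (δ ∘ suc) (T ∘ suc)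
                   (absorbent-sliceʳ sink K) i

c₁≢c₂ : c₁ ≢ c₂
c₁≢c₂ ()

other : Color → Color
other c₁ = c₂
other c₂ = c₁

other-involutive : ∀ c → other (other c) ≡ c
other-involutive c₁ = refl
other-involutive c₂ = refl

is-c₁ : Color → Bool
is-c₁ c₁ = true
is-c₁ c₂ = false

is-c₁-true : ∀ {c} → is-c₁ c ≡ true → c ≡ c₁
is-c₁-true {c₁} _ = refl

is-c₁-false : ∀ {c} → is-c₁ c ≡ false → c ≡ c₂
is-c₁-false {c₂} _ = refl

is-c₁-other : ∀ {c} → is-c₁ (other c) ≡ true → c ≡ c₂
is-c₁-other {c₂} _ = refl

last-or-inject₁ : ∀ {m} (v : Fin (suc m)) → v ≡ fromℕ m ⊎ ∃ λ k → v ≡ inject₁ k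
last-or-inject₁ v with view v
... | ‵fromℕ = inj₁ refl
... | ‵inj₁ {i = k} _ = inj₂ (k , refl)

inject₁≢suc : ∀ {m} (i : Fin m) → inject₁ i ≢ suc i
inject₁≢suc zero ()
inject₁≢suc (suc i) = inject₁≢suc i ∘ suc-injective

-- Arc i of a path joins `inject₁ i` to `suc i`; adjacency of arcs j and k is `suc j ≡ inject₁ k`.
record Alternating (p : BiPath) : Set where
  field
    starts-c₂ : ∀ i → inject₁ i ≡ zero → col p i ≡ c₂
    ends-c₁ : ∀ i → suc i ≡ fromℕ (len p) → col p i ≡ c₁
    alternates : ∀ j k → suc j ≡ inject₁ k → col p k ≡ other (col p j)

module _ (p : BiPath) where

  private
    P = pathD p

  no-arc-into-zero : ∀ {c u} → ¬ arc P c u zero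
  no-arc-into-zero (_ , _ , () , _)

  no-arc-out-of-last : ∀ {c v} → ¬ arc P c (fromℕ (len p)) v
  no-arc-out-of-last (_ , e , _ , _) = fromℕ≢inject₁ e

  arc-out-of-inject₁ : ∀ {c i v} → arc P c (inject₁ i) v → col p i ≡ c
  arc-out-of-inject₁ (j , e , _ , cj) with inject₁-injective e
  ... | refl = cj

  arc-into-suc : ∀ {c i u} → arc P c u (suc i) → col p i ≡ c
  arc-into-suc (j , _ , e , cj) with suc-injective e
  ... | refl = cj

  zero-isSource : IsSource P zero
  zero-isSource = walk-into-stuck {D = P} no-arc-into-zero

  last-isSink : IsSink P (fromℕ (len p))
  last-isSink = walk-from-stuck {D = P} no-arc-out-of-last

  arc-not-independent : ∀ {B} i → Independent P B → B (inject₁ i) ≡ true → B (suc i) ≡ true → ⊥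
  arc-not-independent i ind Bu Bv =
    ind _ _ Bu Bv (inject₁≢suc i) (col p i) ((i , refl , refl , refl) ◅ ε)

  module _ {L U : V P → Bool}
           (indL : Independent P L) (domL : Dominating P L)
           (indU : Independent P U) (absU : Absorbent P U) where

    L-zero : L zero ≡ true
    L-zero = covers-uncovered {P} zero-isSource domL

    U-last : U (fromℕ (len p)) ≡ true
    U-last = covers-uncovered {P} last-isSink absU

    L-head-c₁ : ∀ i → col p i ≡ c₁ → L (suc i) ≡ true
    L-head-c₁ i ci = covers-uncovered {P} (walk-into-stuck {D = P} no-c₂-arc) domL
      where
      no-c₂-arc : ∀ {u} → ¬ arc P c₂ u (suc i)
      no-c₂-arc a = c₁≢c₂ (trans (sym ci) (arc-into-suc a))

    U-tail-c₂ : ∀ i → col p i ≡ c₂ → U (inject₁ i) ≡ true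
    U-tail-c₂ i ci = covers-uncovered {P} (walk-from-stuck {D = P} no-c₁-arc) absU
      where
      no-c₁-arc : ∀ {v} → ¬ arc P c₁ (inject₁ i) v
      no-c₁-arc a = c₁≢c₂ (trans (sym (arc-out-of-inject₁ a)) ci)

    alternating-of-half-kernels : Alternating p
    alternating-of-half-kernels = record
      { starts-c₂ = starts ; ends-c₁ = ends ; alternates = alternates }
      where
      starts : ∀ i → inject₁ i ≡ zero → col p i ≡ c₂
      starts i e with col p i in ci
      ... | c₂ = refl
      ... | c₁ = ⊥-elim (arc-not-independent i indL (trans (cong L e) L-zero) (L-head-c₁ i ci))

      ends : ∀ i → suc i ≡ fromℕ (len p) → col p i ≡ c₁
      ends i e with col p i in ci
      ... | c₁ = refl
      ... | c₂ = ⊥-elim (arc-not-independent i indU (U-tail-c₂ i ci) (trans (cong U e) U-last))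

      alternates : ∀ j k → suc j ≡ inject₁ k → col p k ≡ other (col p j)
      alternates j k e with col p j in cj | col p k in ck
      ... | c₁ | c₂ = refl
      ... | c₂ | c₁ = refl
      ... | c₁ | c₁ = ⊥-elim (arc-not-independent k indL
                                (trans (cong L (sym e)) (L-head-c₁ j cj)) (L-head-c₁ k ck))
      ... | c₂ | c₂ = ⊥-elim (arc-not-independent j indU
                                (U-tail-c₂ j cj) (trans (cong U e) (U-tail-c₂ k ck)))

  module _ (alt : Alternating p) where

    open Alternating alt

    not-c₂-head : V P → Bool
    not-c₂-head zero = true
    not-c₂-head (suc i) = is-c₁ (col p i)

    not-c₂-head-tail : ∀ i → not-c₂-head (inject₁ i) ≡ is-c₁ (other (col p i))
    not-c₂-head-tail zero = cong (is-c₁ ∘ other) (sym (starts-c₂ zero refl))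
    not-c₂-head-tail (suc i) = begin
      is-c₁ (col p (inject₁ i))                 ≡⟨ cong is-c₁ (sym (other-involutive _)) ⟩
      is-c₁ (other (other (col p (inject₁ i))))
        ≡⟨ cong (is-c₁ ∘ other) (sym (alternates (inject₁ i) (suc i) refl)) ⟩
      is-c₁ (other (col p (suc i)))             ∎
      where open ≡-Reasoning

    c₂-walk-after-c₂ : ∀ {i v} → col p i ≡ c₂ → MonoPath P c₂ (suc i) v → not-c₂-head v ≡ true → ⊥
    c₂-walk-after-c₂ ci ε Bv = c₁≢c₂ (trans (sym (is-c₁-true Bv)) ci)
    c₂-walk-after-c₂ {i} ci ((k , e , refl , ck) ◅ _) _ =
      c₁≢c₂ (trans (sym (trans (alternates i k e) (cong other ci))) ck)

    independent : Independent P not-c₂-head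
    independent u .u _ _ u≢u _ ε = u≢u refl
    independent _ v Bu Bv _ c ((i , refl , refl , ci) ◅ w)
      with trans (sym ci) (is-c₁-other (trans (sym (not-c₂-head-tail i)) Bu))
    ... | refl = c₂-walk-after-c₂ ci w Bv

    absorbent : Absorbent P not-c₂-head
    absorbent zero ()
    absorbent (suc i) out with last-or-inject₁ (suc i)
    ... | inj₁ e = ⊥-elim (c₁≢c₂ (trans (sym (ends-c₁ i e)) (is-c₁-false out)))
    ... | inj₂ (k , e) = suc k , cong is-c₁ ck , (k , e , refl , ck) ◅ ε
      where
      ck : col p k ≡ c₁
      ck = trans (alternates i k e) (cong other (is-c₁-false out))

    dominating : Dominating P not-c₂-head
    dominating zero ()
    dominating (suc i) out = inject₁ i , tail-in , (i , refl , refl , ci) ◅ ε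
      where
      ci : col p i ≡ c₂
      ci = is-c₁-false out
      tail-in : not-c₂-head (inject₁ i) ≡ true
      tail-in = trans (not-c₂-head-tail i) (cong (is-c₁ ∘ other) ci)

    alternating-bikernel : HasBikernel P
    alternating-bikernel = not-c₂-head , (zero , refl) , independent , absorbent , dominating

  path-bikernel : HasIndependentDominating P → HasIndependentAbsorbent P → HasBikernel P
  path-bikernel (L , indL , domL) (U , indU , absU) =
    alternating-bikernel (alternating-of-half-kernels indL domL indU absU)

mainTheorem6 : (n : ℕ) (γ : Fin (suc n) → BiPath) →
    (HasBikernel (⨂ n (λ i → pathD (γ i))) → ∀ i → HasBikernel (pathD (γ i)))
    × ((∀ i → HasBikernel (pathD (γ i))) → HasBikernel (⨂ n (λ i → pathD (γ i))))
mainTheorem6 n γ = only-if , ⨂-bikernel n paths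
  where
  paths : Fin (suc n) → BiDigraph
  paths i = pathD (γ i)

  only-if : HasBikernel (⨂ n paths) → ∀ i → HasBikernel (paths i)
  only-if (B , _ , ind , abs , dom) i = path-bikernel (γ i)
    (⨂-dominating-factor n paths (λ j → zero , zero-isSource (γ j)) (B , ind , dom) i)
    (⨂-absorbent-factor n paths (λ j → fromℕ (len (γ j)) , last-isSink (γ j)) (B , ind , abs) i)
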